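{- Let $q = p_1^{a_1}\cdots p_r^{a_r}$ with $r > 1$, primes $p_1 < \cdots < p_r$ and $a_i \ge 1$. Then $-1$ is an adjacency eigenvalue of the Lee graph $G(n,q)$ for every integer \[ n > \begin{cases} \dfrac{ -1 + (2p_1 - 1)(p_2 - 1)}{2} & \text{if } q \text{ is even},\\[8pt] \dfrac{ -1 + (p_1 - 1)(p_2 - 1)}{2} & \text{if } q \text{ is odd}.\end{cases} \]
   Context: The Lee graph $G(n,q)$ is the $n$-fold Cartesian product of the cycle $C_q$ with itself; its adjacency eigenvalues are $\sum_{j=1}^n 2\cos(2\pi l_j/q)$ for $l_1,\ldots,l_n\in[1,q]$. -}

module Defs where

open import Data.Bool using (Bool; true; false; _∧_; _∨_; if_then_else_)
open import Data.Nat using (ℕ; zero; suc; _+_; _*_; _∸_; _^_; _%_; _≡ᵇ_)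
open import Data.Nat.Divisibility using (_∣?_)
open import Data.Fin using (Fin; toℕ)
open import Data.Fin.Properties using () renaming (_≟_ to _≟ᶠ_)
open import Data.Vec using (Vec; []; _∷_)
open import Data.List using (List; []; _∷_; map; concatMap; allFin; foldr)
open import Data.Integer using (ℤ) renaming (_+_ to _+ℤ_; _*_ to _*ℤ_)
import Data.Integer as ℤ
open import Relation.Nullary using (does)

prodFin : (r : ℕ) → (Fin r → ℕ) → ℕ
prodFin zero    f = 1
prodFin (suc r) f = f Fin.zero * prodFin r (λ i → f (Fin.suc i))
  where import Data.Fin as Fin

Vertex : ℕ → ℕ → Set
Vertex n q = Vec (Fin q) n

allVertices : (n q : ℕ) → List (Vertex n q)
allVertices zero    q = [] ∷ []
allVertices (suc n) q = concatMap (λ a → map (a ∷_) (allVertices n q)) (allFin q)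

-- (k + 1) mod q, for k < q.
sucMod : ℕ → ℕ → ℕ
sucMod q k = if suc k ≡ᵇ q then 0 else suc k

cycleAdj : {q : ℕ} → Fin q → Fin q → Bool
cycleAdj {q} a b = (toℕ b ≡ᵇ sucMod q (toℕ a)) ∨ (toℕ a ≡ᵇ sucMod q (toℕ b))

vecEq : {n q : ℕ} → Vertex n q → Vertex n q → Bool
vecEq []      []      = true
vecEq (a ∷ u) (b ∷ v) = does (a ≟ᶠ b) ∧ vecEq u v

-- Adjacency in the Cartesian product C_q □ ... □ C_q (n factors):
-- (a,u) ~ (b,v) iff (a ~ b in C_q and u = v) or (a = b and u ~ v).
leeAdj : {n q : ℕ} → Vertex n q → Vertex n q → Bool
leeAdj []      []      = false
leeAdj (a ∷ u) (b ∷ v) = (cycleAdj a b ∧ vecEq u v) ∨ (does (a ≟ᶠ b) ∧ leeAdj u v)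

adjMatrix : (n q : ℕ) → Vertex n q → Vertex n q → ℤ
adjMatrix n q x y = if leeAdj x y then ℤ.1ℤ else ℤ.0ℤ

adjApply : (n q : ℕ) → (Vertex n q → ℤ) → Vertex n q → ℤ
adjApply n q v x = foldr _+ℤ_ ℤ.0ℤ (map (λ y → adjMatrix n q x y *ℤ v y) (allVertices n q))

-- Eigenvectors are built from vectors x ↦ H(c₁x₁ + ⋯ + cₘxₘ) with H periodic modulo a divisor of q:
-- the adjacency operator maps such a vector to another function of the same linear form, so an
-- eigenvalue equation for it is an identity about H alone. Eigenvalues add under the Cartesian product
-- G(k + n, q) = G(k, q) □ G(n, q). An odd divisor 2m+1 of q gives the eigenvalue -1 on G(m, q), the
-- constant vector gives 2 on G(1, q) and, for even q, the alternating vector gives -2 on G(1, q); the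
-- Frobenius coin bound for two coprime block sizes then fills every dimension n above the stated bound.
module Submission where

open import Defs
open import Data.Nat
  using (ℕ; zero; suc; _+_; _*_; _∸_; _^_; _<_; _≤_; s≤s; z≤n; _≡ᵇ_; _%_; _/_; NonZero; nonTrivial⇒n>1)
open import Data.Nat.Divisibility
  using (_∣_; divides; divides-refl; 1∣_; ∣-trans; m∣m*n; n∣m*n; _∣?_; ∣⇒≤)
open import Data.Nat.Primality using (Prime; prime⇒irreducible; prime⇒nonZero; prime⇒nonTrivial)
open import Data.Nat.Properties using (<-trans)
import Data.Nat.Properties as ℕ
open import Data.Nat.DivMod using ([m+n]%n≡m%n; m<n⇒m%n≡m; m≡m%n+[m/n]*n; m%n<n)
open import Data.Nat.GCD using (module Bézout)
open import Data.Nat.Coprimality using (Coprime; coprime-Bézout; prime⇒coprime)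
import Data.Nat.Coprimality as Coprime
open import Data.Bool using (Bool; true; false; _∧_; _∨_; if_then_else_; T)
open import Data.Bool.Properties using (∨-identityʳ)
open import Data.Fin using (Fin; toℕ; fromℕ<) renaming (_<_ to _<ᶠ_)
import Data.Fin as Fin
open import Data.Fin.Properties using (toℕ<n; toℕ-fromℕ<; fromℕ<-toℕ) renaming (_≟_ to _≟ᶠ_)
open import Data.Vec using (Vec; []; _∷_; _++_; take; drop; replicate)
import Data.Vec as Vec
open import Data.Vec.Properties using (take++drop≡id; ++-injective)
open import Data.List using (List; []; _∷_; map; concatMap; foldr; allFin)
import Data.List as List
open import Data.List.Properties using (map-tabulate)
open import Data.Integer using (ℤ; -1ℤ; 0ℤ; 1ℤ; +_; -_) renaming (_+_ to _+ℤ_; _*_ to _*ℤ_; _-_ to _-ℤ_)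
import Data.Integer.Properties as ℤ
import Data.Integer.Tactic.RingSolver as ℤ-Solver
import Data.Nat.Tactic.RingSolver as ℕ-Solver
open import Data.Product using (Σ; _×_; ∃; ∃₂; _,_)
open import Data.Sum using (inj₁; inj₂)
open import Data.Empty using (⊥-elim)
open import Function using (_∘_; _⇔_; mk⇔; flip)
open import Relation.Nullary using (¬_; does; yes; no)
open import Relation.Nullary.Decidable using (does-⇔; dec-true; dec-false)
open import Relation.Binary.PropositionalEquality

private
  variable
    U V : Set

∑ : List U → (U → ℤ) → ℤ
∑ xs f = foldr _+ℤ_ 0ℤ (map f xs)

𝟙 : Bool → ℤ
𝟙 b = if b then 1ℤ else 0ℤ

∑-++ : (xs ys : List U) (f : U → ℤ) → ∑ (xs List.++ ys) f ≡ ∑ xs f +ℤ ∑ ys f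
∑-++ []       ys f = sym (ℤ.+-identityˡ _)
∑-++ (x ∷ xs) ys f = trans (cong (f x +ℤ_) (∑-++ xs ys f)) (sym (ℤ.+-assoc (f x) _ _))

∑-concatMap : (g : U → List V) (xs : List U) (f : V → ℤ) →
              ∑ (concatMap g xs) f ≡ ∑ xs (λ a → ∑ (g a) f)
∑-concatMap g []       f = refl
∑-concatMap g (x ∷ xs) f = trans (∑-++ (g x) (concatMap g xs) f) (cong (∑ (g x) f +ℤ_) (∑-concatMap g xs f))

∑-map : (h : U → V) (xs : List U) (f : V → ℤ) → ∑ (map h xs) f ≡ ∑ xs (f ∘ h)
∑-map h []       f = refl
∑-map h (x ∷ xs) f = cong (f (h x) +ℤ_) (∑-map h xs f)

∑-cong : (xs : List U) {f g : U → ℤ} → (∀ x → f x ≡ g x) → ∑ xs f ≡ ∑ xs g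
∑-cong []       f≗g = refl
∑-cong (x ∷ xs) f≗g = cong₂ _+ℤ_ (f≗g x) (∑-cong xs f≗g)

∑-+ : (xs : List U) (f g : U → ℤ) → ∑ xs (λ x → f x +ℤ g x) ≡ ∑ xs f +ℤ ∑ xs g
∑-+ []       f g = refl
∑-+ (x ∷ xs) f g = trans (cong (f x +ℤ g x +ℤ_) (∑-+ xs f g)) (swap (f x) (g x) (∑ xs f) (∑ xs g))
  where
  swap : ∀ a b c d → a +ℤ b +ℤ (c +ℤ d) ≡ a +ℤ c +ℤ (b +ℤ d)
  swap = ℤ-Solver.solve-∀

∑-*ˡ : (xs : List U) (c : ℤ) (f : U → ℤ) → ∑ xs (λ x → c *ℤ f x) ≡ c *ℤ ∑ xs f
∑-*ˡ []       c f = sym (ℤ.*-zeroʳ c)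
∑-*ˡ (x ∷ xs) c f = trans (cong (c *ℤ f x +ℤ_) (∑-*ˡ xs c f)) (sym (ℤ.*-distribˡ-+ c (f x) _))

∑-zero : (xs : List U) → ∑ xs (λ _ → 0ℤ) ≡ 0ℤ
∑-zero []       = refl
∑-zero (x ∷ xs) = trans (ℤ.+-identityˡ _) (∑-zero xs)

∑-allFin-suc : ∀ n (f : Fin (suc n) → ℤ) →
               ∑ (allFin (suc n)) f ≡ f Fin.zero +ℤ ∑ (allFin n) (f ∘ Fin.suc)
∑-allFin-suc n f = cong (λ fs → f Fin.zero +ℤ foldr _+ℤ_ 0ℤ fs)
  (trans (map-tabulate Fin.suc f) (sym (map-tabulate (λ i → i) (f ∘ Fin.suc))))

∑-allFin-≡ᵇ : ∀ {q k} (k<q : k < q) (h : Fin q → ℤ) →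
              ∑ (allFin q) (λ b → 𝟙 (toℕ b ≡ᵇ k) *ℤ h b) ≡ h (fromℕ< k<q)
∑-allFin-≡ᵇ {suc q} {zero} k<q h = begin
  ∑ (allFin (suc q)) (λ b → 𝟙 (toℕ b ≡ᵇ 0) *ℤ h b)
    ≡⟨ ∑-allFin-suc q (λ b → 𝟙 (toℕ b ≡ᵇ 0) *ℤ h b) ⟩
  1ℤ *ℤ h Fin.zero +ℤ ∑ (allFin q) (λ b → 0ℤ *ℤ h (Fin.suc b))
    ≡⟨ cong (1ℤ *ℤ h Fin.zero +ℤ_) (∑-zero (allFin q)) ⟩
  1ℤ *ℤ h Fin.zero +ℤ 0ℤ
    ≡⟨ trans (ℤ.+-identityʳ _) (ℤ.*-identityˡ _) ⟩
  h Fin.zero ∎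
  where open ≡-Reasoning
∑-allFin-≡ᵇ {suc q} {suc k} (s≤s k<q) h =
  trans (∑-allFin-suc q (λ b → 𝟙 (toℕ b ≡ᵇ suc k) *ℤ h b))
        (trans (ℤ.+-identityˡ _) (∑-allFin-≡ᵇ k<q (h ∘ Fin.suc)))

does-≟ᶠ : ∀ {q} (a b : Fin q) → does (a ≟ᶠ b) ≡ (toℕ b ≡ᵇ toℕ a)
does-≟ᶠ Fin.zero    Fin.zero    = refl
does-≟ᶠ Fin.zero    (Fin.suc b) = refl
does-≟ᶠ (Fin.suc a) Fin.zero    = refl
does-≟ᶠ (Fin.suc a) (Fin.suc b) = does-≟ᶠ a b

∑-allFin-≟ : ∀ {q} (a : Fin q) (h : Fin q → ℤ) → ∑ (allFin q) (λ b → 𝟙 (does (a ≟ᶠ b)) *ℤ h b) ≡ h a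
∑-allFin-≟ {q} a h = begin
  ∑ (allFin q) (λ b → 𝟙 (does (a ≟ᶠ b)) *ℤ h b)
    ≡⟨ ∑-cong (allFin q) (λ b → cong (λ x → 𝟙 x *ℤ h b) (does-≟ᶠ a b)) ⟩
  ∑ (allFin q) (λ b → 𝟙 (toℕ b ≡ᵇ toℕ a) *ℤ h b)
    ≡⟨ ∑-allFin-≡ᵇ (toℕ<n a) h ⟩
  h (fromℕ< (toℕ<n a))
    ≡⟨ cong h (fromℕ<-toℕ a (toℕ<n a)) ⟩
  h a ∎
  where open ≡-Reasoning

𝟙-∧ : ∀ x y → 𝟙 (x ∧ y) ≡ 𝟙 x *ℤ 𝟙 y
𝟙-∧ false y = refl
𝟙-∧ true  y = sym (ℤ.*-identityˡ _)

𝟙-∨-disjoint : ∀ x y → (T x → ¬ T y) → 𝟙 (x ∨ y) ≡ 𝟙 x +ℤ 𝟙 y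
𝟙-∨-disjoint false y     _        = sym (ℤ.+-identityˡ _)
𝟙-∨-disjoint true  false _        = refl
𝟙-∨-disjoint true  true  disjoint = ⊥-elim (disjoint _ _)

predMod : ℕ → ℕ → ℕ
predMod q zero    = q ∸ 1
predMod q (suc k) = k

sucMod-wrap : ∀ {q k} → suc k ≡ q → sucMod q k ≡ 0
sucMod-wrap {q} {k} e rewrite dec-true (suc k ℕ.≟ q) e = refl

sucMod-noWrap : ∀ {q k} → suc k ≢ q → sucMod q k ≡ suc k
sucMod-noWrap {q} {k} e rewrite dec-false (suc k ℕ.≟ q) e = refl

sucMod< : ∀ {q k} → k < q → sucMod q k < q
sucMod< {q} {k} k<q with suc k ℕ.≟ q
... | yes e = subst (_< q) (sym (sucMod-wrap e)) (ℕ.≤-<-trans z≤n k<q)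
... | no ¬e = subst (_< q) (sym (sucMod-noWrap ¬e)) (ℕ.≤∧≢⇒< k<q ¬e)

predMod< : ∀ {q k} → k < q → predMod q k < q
predMod< {suc q} {zero}  _   = ℕ.n<1+n q
predMod< {q}     {suc k} k<q = <-trans (ℕ.n<1+n k) k<q

≡sucMod⇔predMod≡ : ∀ {q i j} → i < q → j < q → (i ≡ sucMod q j) ⇔ (j ≡ predMod q i)
≡sucMod⇔predMod≡ {q} {i} {j} i<q j<q = mk⇔ (to i) (from i i<q)
  where
  to : ∀ i → i ≡ sucMod q j → j ≡ predMod q i
  to i refl with suc j ℕ.≟ q
  ... | yes e rewrite sucMod-wrap e = cong (_∸ 1) e
  ... | no ¬e rewrite sucMod-noWrap ¬e = refl
  from : ∀ i → i < q → j ≡ predMod q i → i ≡ sucMod q j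
  from zero    _   refl = sym (sucMod-wrap (ℕ.m+[n∸m]≡n (ℕ.≤-trans (s≤s z≤n) j<q)))
  from (suc i) i<q refl = sym (sucMod-noWrap (ℕ.<⇒≢ i<q))

sucMod≢predMod : ∀ {q k} → 2 < q → sucMod q k ≢ predMod q k
sucMod≢predMod {q} {k} 2<q with suc k ℕ.≟ q
sucMod≢predMod {q} {zero}  (s≤s ()) | yes refl
sucMod≢predMod {q} {zero}  2<q | no ¬e rewrite sucMod-noWrap ¬e = 1≢q∸1 2<q
  where
  1≢q∸1 : ∀ {q} → 2 < q → 1 ≢ q ∸ 1
  1≢q∸1 {suc (suc zero)}    (s≤s (s≤s ()))
  1≢q∸1 {suc (suc (suc q))} _ ()
sucMod≢predMod {q} {suc k} 2<q | yes e rewrite sucMod-wrap e = 0≢k e 2<q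
  where
  0≢k : ∀ {k q} → suc (suc k) ≡ q → 2 < q → 0 ≢ k
  0≢k {zero}  refl (s≤s (s≤s ()))
  0≢k {suc k} _    _ ()
sucMod≢predMod {q} {suc k} 2<q | no ¬e rewrite sucMod-noWrap ¬e =
  λ e → ℕ.<⇒≢ (<-trans (ℕ.n<1+n k) (ℕ.n<1+n (suc k))) (sym e)

sucMod≢id : ∀ {q k} → 1 < q → k ≢ sucMod q k
sucMod≢id {q} {k} 1<q with suc k ℕ.≟ q
sucMod≢id {q} {zero}  (s≤s ()) | yes refl
sucMod≢id {q} {suc k} 1<q      | yes e rewrite sucMod-wrap e = λ ()
... | no ¬e rewrite sucMod-noWrap ¬e = ℕ.<⇒≢ (ℕ.n<1+n k)

cycleAdj-irrefl : ∀ {q} → 1 < q → (a : Fin q) → cycleAdj a a ≡ false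
cycleAdj-irrefl 1<q a rewrite dec-false (toℕ a ℕ.≟ _) (sucMod≢id 1<q) = refl

cycleAdj≡sucMod∨predMod : ∀ {q} (a b : Fin q) →
  cycleAdj a b ≡ (toℕ b ≡ᵇ sucMod q (toℕ a)) ∨ (toℕ b ≡ᵇ predMod q (toℕ a))
cycleAdj≡sucMod∨predMod {q} a b = cong ((toℕ b ≡ᵇ sucMod q (toℕ a)) ∨_)
  (does-⇔ (≡sucMod⇔predMod≡ (toℕ<n a) (toℕ<n b)) (toℕ a ℕ.≟ _) (toℕ b ℕ.≟ _))

∑-cycleAdj : ∀ {q} → 2 < q → (a : Fin q) (G : ℕ → ℤ) →
  ∑ (allFin q) (λ b → 𝟙 (cycleAdj a b) *ℤ G (toℕ b)) ≡ G (sucMod q (toℕ a)) +ℤ G (predMod q (toℕ a))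
∑-cycleAdj {q} 2<q a G = begin
  ∑ (allFin q) (λ b → 𝟙 (cycleAdj a b) *ℤ G (toℕ b))
    ≡⟨ ∑-cong (allFin q) split ⟩
  ∑ (allFin q) (λ b → 𝟙 (toℕ b ≡ᵇ s) *ℤ G (toℕ b) +ℤ 𝟙 (toℕ b ≡ᵇ p) *ℤ G (toℕ b))
    ≡⟨ ∑-+ (allFin q) _ _ ⟩
  ∑ (allFin q) (λ b → 𝟙 (toℕ b ≡ᵇ s) *ℤ G (toℕ b)) +ℤ
  ∑ (allFin q) (λ b → 𝟙 (toℕ b ≡ᵇ p) *ℤ G (toℕ b))
    ≡⟨ cong₂ _+ℤ_ (pick (sucMod< (toℕ<n a))) (pick (predMod< (toℕ<n a))) ⟩
  G s +ℤ G p ∎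
  where
  open ≡-Reasoning
  s = sucMod q (toℕ a)
  p = predMod q (toℕ a)
  split : ∀ b → 𝟙 (cycleAdj a b) *ℤ G (toℕ b)
                ≡ 𝟙 (toℕ b ≡ᵇ s) *ℤ G (toℕ b) +ℤ 𝟙 (toℕ b ≡ᵇ p) *ℤ G (toℕ b)
  split b = begin
    𝟙 (cycleAdj a b) *ℤ G (toℕ b)
      ≡⟨ cong (λ x → 𝟙 x *ℤ G (toℕ b)) (cycleAdj≡sucMod∨predMod a b) ⟩
    𝟙 ((toℕ b ≡ᵇ s) ∨ (toℕ b ≡ᵇ p)) *ℤ G (toℕ b)
      ≡⟨ cong (_*ℤ G (toℕ b)) (𝟙-∨-disjoint _ _ disjoint) ⟩
    (𝟙 (toℕ b ≡ᵇ s) +ℤ 𝟙 (toℕ b ≡ᵇ p)) *ℤ G (toℕ b)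
      ≡⟨ ℤ.*-distribʳ-+ (G (toℕ b)) (𝟙 (toℕ b ≡ᵇ s)) (𝟙 (toℕ b ≡ᵇ p)) ⟩
    𝟙 (toℕ b ≡ᵇ s) *ℤ G (toℕ b) +ℤ 𝟙 (toℕ b ≡ᵇ p) *ℤ G (toℕ b) ∎
    where
    disjoint : T (toℕ b ≡ᵇ s) → ¬ T (toℕ b ≡ᵇ p)
    disjoint b≡s b≡p =
      sucMod≢predMod 2<q (trans (sym (ℕ.≡ᵇ⇒≡ (toℕ b) s b≡s)) (ℕ.≡ᵇ⇒≡ (toℕ b) p b≡p))
  pick : ∀ {k} (k<q : k < q) → ∑ (allFin q) (λ b → 𝟙 (toℕ b ≡ᵇ k) *ℤ G (toℕ b)) ≡ G k
  pick k<q = trans (∑-allFin-≡ᵇ k<q (G ∘ toℕ)) (cong G (toℕ-fromℕ< k<q))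

∑-pullˡ : (xs : List U) (c : ℤ) (f g : U → ℤ) →
          ∑ xs (λ x → c *ℤ f x *ℤ g x) ≡ c *ℤ ∑ xs (λ x → f x *ℤ g x)
∑-pullˡ xs c f g = trans (∑-cong xs (λ x → ℤ.*-assoc c (f x) (g x))) (∑-*ˡ xs c (λ x → f x *ℤ g x))

∑-allVertices-∷ : ∀ n q (f : Vertex (suc n) q → ℤ) →
  ∑ (allVertices (suc n) q) f ≡ ∑ (allFin q) (λ b → ∑ (allVertices n q) (λ w → f (b ∷ w)))
∑-allVertices-∷ n q f = trans (∑-concatMap (λ b → map (b ∷_) (allVertices n q)) (allFin q) f)
                              (∑-cong (allFin q) (λ b → ∑-map (b ∷_) (allVertices n q) f))

∑-allVertices-vecEq : ∀ {n q} (u : Vertex n q) (f : Vertex n q → ℤ) →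
  ∑ (allVertices n q) (λ w → 𝟙 (vecEq u w) *ℤ f w) ≡ f u
∑-allVertices-vecEq {zero}      []      f = trans (ℤ.+-identityʳ _) (ℤ.*-identityˡ _)
∑-allVertices-vecEq {suc n} {q} (a ∷ u) f = begin
  ∑ (allVertices (suc n) q) (λ w → 𝟙 (vecEq (a ∷ u) w) *ℤ f w)
    ≡⟨ ∑-allVertices-∷ n q (λ w → 𝟙 (vecEq (a ∷ u) w) *ℤ f w) ⟩
  ∑ (allFin q) (λ b → ∑ (allVertices n q) (λ w → 𝟙 (does (a ≟ᶠ b) ∧ vecEq u w) *ℤ f (b ∷ w)))
    ≡⟨ ∑-cong (allFin q) (λ b → ∑-cong (allVertices n q) (λ w →
         cong (_*ℤ f (b ∷ w)) (𝟙-∧ (does (a ≟ᶠ b)) (vecEq u w)))) ⟩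
  ∑ (allFin q) (λ b → ∑ (allVertices n q) (λ w → 𝟙 (does (a ≟ᶠ b)) *ℤ 𝟙 (vecEq u w) *ℤ f (b ∷ w)))
    ≡⟨ ∑-cong (allFin q) (λ b →
         ∑-pullˡ (allVertices n q) (𝟙 (does (a ≟ᶠ b))) (𝟙 ∘ vecEq u) (λ w → f (b ∷ w))) ⟩
  ∑ (allFin q) (λ b → 𝟙 (does (a ≟ᶠ b)) *ℤ ∑ (allVertices n q) (λ w → 𝟙 (vecEq u w) *ℤ f (b ∷ w)))
    ≡⟨ ∑-cong (allFin q) (λ b →
         cong (𝟙 (does (a ≟ᶠ b)) *ℤ_) (∑-allVertices-vecEq u (λ w → f (b ∷ w)))) ⟩
  ∑ (allFin q) (λ b → 𝟙 (does (a ≟ᶠ b)) *ℤ f (b ∷ u))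
    ≡⟨ ∑-allFin-≟ a (λ b → f (b ∷ u)) ⟩
  f (a ∷ u) ∎
  where open ≡-Reasoning

𝟙-leeAdj-∷ : ∀ {n q} {a b : Fin q} {u w : Vertex n q} → cycleAdj a a ≡ false →
  𝟙 (leeAdj (a ∷ u) (b ∷ w))
  ≡ 𝟙 (cycleAdj a b) *ℤ 𝟙 (vecEq u w) +ℤ 𝟙 (does (a ≟ᶠ b)) *ℤ 𝟙 (leeAdj u w)
𝟙-leeAdj-∷ {a = a} {b} {u} {w} irrefl with a ≟ᶠ b
... | yes refl rewrite irrefl = sym (trans (ℤ.+-identityˡ _) (ℤ.*-identityˡ _))
... | no _ =
  trans (cong 𝟙 (∨-identityʳ _)) (trans (𝟙-∧ (cycleAdj a b) (vecEq u w)) (sym (ℤ.+-identityʳ _)))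

adjApply-∷ : ∀ {n q} → 1 < q → (v : Vertex (suc n) q → ℤ) (a : Fin q) (u : Vertex n q) →
  adjApply (suc n) q v (a ∷ u)
  ≡ ∑ (allFin q) (λ b → 𝟙 (cycleAdj a b) *ℤ v (b ∷ u)) +ℤ adjApply n q (λ w → v (a ∷ w)) u
adjApply-∷ {n} {q} 1<q v a u = begin
  adjApply (suc n) q v (a ∷ u)
    ≡⟨ ∑-allVertices-∷ n q _ ⟩
  ∑ (allFin q) (λ b → ∑ (allVertices n q) (λ w → 𝟙 (leeAdj (a ∷ u) (b ∷ w)) *ℤ v (b ∷ w)))
    ≡⟨ ∑-cong (allFin q) (λ b → ∑-cong (allVertices n q) (λ w → split b w)) ⟩
  ∑ (allFin q) (λ b → ∑ (allVertices n q) (λ w →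
    C b *ℤ 𝟙 (vecEq u w) *ℤ v (b ∷ w) +ℤ E b *ℤ 𝟙 (leeAdj u w) *ℤ v (b ∷ w)))
    ≡⟨ ∑-cong (allFin q) (λ b → ∑-+ (allVertices n q) _ _) ⟩
  ∑ (allFin q) (λ b → ∑ (allVertices n q) (λ w → C b *ℤ 𝟙 (vecEq u w) *ℤ v (b ∷ w))
                   +ℤ ∑ (allVertices n q) (λ w → E b *ℤ 𝟙 (leeAdj u w) *ℤ v (b ∷ w)))
    ≡⟨ ∑-+ (allFin q) _ _ ⟩
  ∑ (allFin q) (λ b → ∑ (allVertices n q) (λ w → C b *ℤ 𝟙 (vecEq u w) *ℤ v (b ∷ w)))
    +ℤ ∑ (allFin q) (λ b → ∑ (allVertices n q) (λ w → E b *ℤ 𝟙 (leeAdj u w) *ℤ v (b ∷ w)))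
    ≡⟨ cong₂ _+ℤ_ (∑-cong (allFin q) cycleStep) neighbourStep ⟩
  ∑ (allFin q) (λ b → C b *ℤ v (b ∷ u)) +ℤ adjApply n q (λ w → v (a ∷ w)) u ∎
  where
  open ≡-Reasoning
  C E : Fin q → ℤ
  C b = 𝟙 (cycleAdj a b)
  E b = 𝟙 (does (a ≟ᶠ b))
  split : ∀ b w → 𝟙 (leeAdj (a ∷ u) (b ∷ w)) *ℤ v (b ∷ w)
                  ≡ C b *ℤ 𝟙 (vecEq u w) *ℤ v (b ∷ w) +ℤ E b *ℤ 𝟙 (leeAdj u w) *ℤ v (b ∷ w)
  split b w = trans (cong (_*ℤ v (b ∷ w)) (𝟙-leeAdj-∷ {a = a} {b} {u} {w} (cycleAdj-irrefl 1<q a)))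
                    (ℤ.*-distribʳ-+ (v (b ∷ w)) (C b *ℤ 𝟙 (vecEq u w)) (E b *ℤ 𝟙 (leeAdj u w)))
  cycleStep : ∀ b → ∑ (allVertices n q) (λ w → C b *ℤ 𝟙 (vecEq u w) *ℤ v (b ∷ w)) ≡ C b *ℤ v (b ∷ u)
  cycleStep b = trans (∑-pullˡ (allVertices n q) (C b) (𝟙 ∘ vecEq u) (λ w → v (b ∷ w)))
                      (cong (C b *ℤ_) (∑-allVertices-vecEq u (λ w → v (b ∷ w))))
  neighbourStep : ∑ (allFin q) (λ b → ∑ (allVertices n q) (λ w → E b *ℤ 𝟙 (leeAdj u w) *ℤ v (b ∷ w)))
                  ≡ adjApply n q (λ w → v (a ∷ w)) u
  neighbourStep =
    trans (∑-cong (allFin q) (λ b → ∑-pullˡ (allVertices n q) (E b) (𝟙 ∘ leeAdj u) (λ w → v (b ∷ w))))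
          (∑-allFin-≟ a (λ b → adjApply n q (λ w → v (b ∷ w)) u))

adjApply-++ : ∀ {k n q} → 1 < q → (v : Vertex (k + n) q → ℤ) (y : Vertex k q) (z : Vertex n q) →
  adjApply (k + n) q v (y ++ z)
  ≡ adjApply k q (λ y′ → v (y′ ++ z)) y +ℤ adjApply n q (λ z′ → v (y ++ z′)) z
adjApply-++               1<q v []      z = sym (ℤ.+-identityˡ _)
adjApply-++ {suc k} {n} {q} 1<q v (a ∷ y) z = begin
  adjApply (suc (k + n)) q v (a ∷ y ++ z)
    ≡⟨ adjApply-∷ 1<q v a (y ++ z) ⟩
  N +ℤ adjApply (k + n) q (λ w → v (a ∷ w)) (y ++ z)
    ≡⟨ cong (N +ℤ_) (adjApply-++ 1<q (λ w → v (a ∷ w)) y z) ⟩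
  N +ℤ (adjApply k q (λ y′ → v (a ∷ y′ ++ z)) y +ℤ adjApply n q (λ z′ → v (a ∷ y ++ z′)) z)
    ≡⟨ sym (ℤ.+-assoc N _ _) ⟩
  N +ℤ adjApply k q (λ y′ → v (a ∷ y′ ++ z)) y +ℤ adjApply n q (λ z′ → v (a ∷ y ++ z′)) z
    ≡⟨ cong (_+ℤ adjApply n q (λ z′ → v (a ∷ y ++ z′)) z)
            (sym (adjApply-∷ 1<q (λ y′ → v (y′ ++ z)) a y)) ⟩
  adjApply (suc k) q (λ y′ → v (y′ ++ z)) (a ∷ y) +ℤ adjApply n q (λ z′ → v (a ∷ y ++ z′)) z ∎
  where
  open ≡-Reasoning
  N = ∑ (allFin q) (λ b → 𝟙 (cycleAdj a b) *ℤ v (b ∷ y ++ z))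

adjApply-cong : ∀ {n q} {v w : Vertex n q → ℤ} → (∀ x → v x ≡ w x) →
                ∀ x → adjApply n q v x ≡ adjApply n q w x
adjApply-cong {n} {q} v≗w x = ∑-cong (allVertices n q) (λ y → cong (adjMatrix n q x y *ℤ_) (v≗w y))

adjApply-*ˡ : ∀ {n q} (c : ℤ) (v : Vertex n q → ℤ) x →
              adjApply n q (λ y → c *ℤ v y) x ≡ c *ℤ adjApply n q v x
adjApply-*ˡ {n} {q} c v x = begin
  adjApply n q (λ y → c *ℤ v y) x
    ≡⟨ ∑-cong (allVertices n q) (λ y → swap (adjMatrix n q x y) c (v y)) ⟩
  ∑ (allVertices n q) (λ y → c *ℤ (adjMatrix n q x y *ℤ v y))
    ≡⟨ ∑-*ˡ (allVertices n q) c (λ y → adjMatrix n q x y *ℤ v y) ⟩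
  c *ℤ adjApply n q v x ∎
  where
  open ≡-Reasoning
  swap : ∀ m c v → m *ℤ (c *ℤ v) ≡ c *ℤ (m *ℤ v)
  swap = ℤ-Solver.solve-∀

record IsEigenvalue (n q : ℕ) (θ : ℤ) : Set where
  constructor eigenvector
  field
    vector   : Vertex n q → ℤ
    nonzero  : ∃ λ x → vector x ≢ 0ℤ
    equation : ∀ x → adjApply n q vector x ≡ θ *ℤ vector x

eigenvalue-zero : ∀ {q} → IsEigenvalue 0 q 0ℤ
eigenvalue-zero = eigenvector (λ _ → 1ℤ) ([] , λ ()) λ { [] → refl }

take-drop-++ : ∀ {k n} (y : Vec U k) (z : Vec U n) → take k (y ++ z) ≡ y × drop k (y ++ z) ≡ z
take-drop-++ {k = k} y z = ++-injective (take k (y ++ z)) y (take++drop≡id k (y ++ z))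

eigenvalue-□ : ∀ {k n q θ φ} → 1 < q →
               IsEigenvalue k q θ → IsEigenvalue n q φ → IsEigenvalue (k + n) q (θ +ℤ φ)
eigenvalue-□ {k} {n} {q} {θ} {φ} 1<q (eigenvector f (y₀ , fy₀≢0) f-eig) (eigenvector g (z₀ , gz₀≢0) g-eig) =
  eigenvector h (y₀ ++ z₀ , hyz₀≢0) λ x → subst (λ x → adjApply (k + n) q h x ≡ (θ +ℤ φ) *ℤ h x)
                                        (take++drop≡id k x) (h-eig (take k x) (drop k x))
  where
  h : Vertex (k + n) q → ℤ
  h x = f (take k x) *ℤ g (drop k x)
  h-++ : ∀ y z → h (y ++ z) ≡ f y *ℤ g z
  h-++ y z = let take≡ , drop≡ = take-drop-++ y z in cong₂ _*ℤ_ (cong f take≡) (cong g drop≡)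
  hyz₀≢0 : h (y₀ ++ z₀) ≢ 0ℤ
  hyz₀≢0 h≡0 with ℤ.i*j≡0⇒i≡0∨j≡0 (f y₀) (trans (sym (h-++ y₀ z₀)) h≡0)
  ... | inj₁ fy₀≡0 = fy₀≢0 fy₀≡0
  ... | inj₂ gz₀≡0 = gz₀≢0 gz₀≡0
  h-eig : ∀ y z → adjApply (k + n) q h (y ++ z) ≡ (θ +ℤ φ) *ℤ h (y ++ z)
  h-eig y z = begin
    adjApply (k + n) q h (y ++ z)
      ≡⟨ adjApply-++ 1<q h y z ⟩
    adjApply k q (λ y′ → h (y′ ++ z)) y +ℤ adjApply n q (λ z′ → h (y ++ z′)) z
      ≡⟨ cong₂ _+ℤ_ (adjApply-cong (λ y′ → trans (h-++ y′ z) (ℤ.*-comm (f y′) (g z))) y)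
                    (adjApply-cong (λ z′ → h-++ y z′) z) ⟩
    adjApply k q (λ y′ → g z *ℤ f y′) y +ℤ adjApply n q (λ z′ → f y *ℤ g z′) z
      ≡⟨ cong₂ _+ℤ_ (adjApply-*ˡ (g z) f y) (adjApply-*ˡ (f y) g z) ⟩
    g z *ℤ adjApply k q f y +ℤ f y *ℤ adjApply n q g z
      ≡⟨ cong₂ _+ℤ_ (cong (g z *ℤ_) (f-eig y)) (cong (f y *ℤ_) (g-eig z)) ⟩
    g z *ℤ (θ *ℤ f y) +ℤ f y *ℤ (φ *ℤ g z)
      ≡⟨ collect θ φ (f y) (g z) ⟩
    (θ +ℤ φ) *ℤ (f y *ℤ g z)
      ≡⟨ cong ((θ +ℤ φ) *ℤ_) (sym (h-++ y z)) ⟩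
    (θ +ℤ φ) *ℤ h (y ++ z) ∎
    where
    open ≡-Reasoning
    collect : ∀ θ φ a b → b *ℤ (θ *ℤ a) +ℤ a *ℤ (φ *ℤ b) ≡ (θ +ℤ φ) *ℤ (a *ℤ b)
    collect = ℤ-Solver.solve-∀

eigenvalue-□-power : ∀ {k q θ} → 1 < q → IsEigenvalue k q θ → ∀ t → IsEigenvalue (t * k) q (+ t *ℤ θ)
eigenvalue-□-power {q = q} {θ} 1<q E zero    = subst (IsEigenvalue 0 q) (sym (ℤ.*-zeroˡ θ)) eigenvalue-zero
eigenvalue-□-power {k} {q} {θ} 1<q E (suc t) =
  subst (IsEigenvalue (k + t * k) q) (sym (ℤ.suc-* (+ t) θ)) (eigenvalue-□ 1<q E (eigenvalue-□-power 1<q E t))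

Periodic : ℕ → (ℕ → ℤ) → Set
Periodic d H = ∀ s → H (s + d) ≡ H s

periodic-* : ∀ {d H} → Periodic d H → ∀ s t → H (s + d * t) ≡ H s
periodic-* {d} {H} per s zero    = cong H (trans (cong (_+_ s) (ℕ.*-zeroʳ d)) (ℕ.+-identityʳ s))
periodic-* {d} {H} per s (suc t) = trans (cong H (unfold s d t)) (trans (per (s + d * t)) (periodic-* per s t))
  where
  unfold : ∀ s d t → s + d * suc t ≡ s + d * t + d
  unfold = ℕ-Solver.solve-∀

periodic-cong : ∀ {d H x y} t t′ → Periodic d H → x + d * t ≡ y + d * t′ → H x ≡ H y
periodic-cong {H = H} {x} {y} t t′ per e = trans (sym (periodic-* per x t)) (trans (cong H e) (periodic-* per y t′))

linearForm : ∀ {m q} → Vec ℕ m → Vertex m q → ℕ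
linearForm []       []      = 0
linearForm (c ∷ cs) (a ∷ u) = c * toℕ a + linearForm cs u

-- For the period suc d, the shift s + c * d stands for s - c.
neighbourSum : ∀ {m} → ℕ → Vec ℕ m → (ℕ → ℤ) → ℕ → ℤ
neighbourSum d []       H s = 0ℤ
neighbourSum d (c ∷ cs) H s = H (s + c) +ℤ H (s + c * d) +ℤ neighbourSum d cs H s

neighbourSum-shift : ∀ {m} d (cs : Vec ℕ m) H x s →
                     neighbourSum d cs (λ t → H (x + t)) s ≡ neighbourSum d cs H (x + s)
neighbourSum-shift d []       H x s = refl
neighbourSum-shift d (c ∷ cs) H x s =
  cong₂ _+ℤ_ (cong₂ _+ℤ_ (cong H (sym (ℕ.+-assoc x s c))) (cong H (sym (ℕ.+-assoc x s (c * d)))))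
             (neighbourSum-shift d cs H x s)

sucMod-congruent : ∀ q k → ∃ λ t → sucMod q k + t * q ≡ suc k
sucMod-congruent q k with suc k ℕ.≟ q
... | yes e = 1 , trans (cong (_+ 1 * q) (sucMod-wrap e)) (trans (ℕ.*-identityˡ q) (sym e))
... | no ¬e = 0 , trans (ℕ.+-identityʳ _) (sucMod-noWrap ¬e)

predMod-congruent : ∀ {q k} → k < q → ∃ λ t → suc (predMod q k) ≡ k + t * q
predMod-congruent {suc q} {zero}  _ = 1 , cong suc (sym (ℕ.+-identityʳ q))
predMod-congruent {q}     {suc k} _ = 0 , sym (ℕ.+-identityʳ (suc k))

module _ {d e : ℕ} {H : ℕ → ℤ} (per : Periodic (suc d) H) where

  private
    q = e * suc d

  periodic-sucMod : ∀ c i L → H (c * sucMod q i + L) ≡ H (c * i + L + c)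
  periodic-sucMod c i L with sucMod-congruent q i
  ... | t , s+tq≡1+i = periodic-cong (c * t * e) 0 per (begin
    c * sucMod q i + L + suc d * (c * t * e) ≡⟨ regroup c (sucMod q i) t e d L ⟩
    c * (sucMod q i + t * q) + L             ≡⟨ cong (λ x → c * x + L) s+tq≡1+i ⟩
    c * suc i + L                            ≡⟨ expand c i L d ⟩
    c * i + L + c + suc d * 0                ∎)
    where
    open ≡-Reasoning
    regroup : ∀ c s t e d L → c * s + L + suc d * (c * t * e) ≡ c * (s + t * (e * suc d)) + L
    regroup = ℕ-Solver.solve-∀
    expand : ∀ c i L d → c * suc i + L ≡ c * i + L + c + suc d * 0
    expand = ℕ-Solver.solve-∀

  periodic-predMod : ∀ {i} → i < q → ∀ c L → H (c * predMod q i + L) ≡ H (c * i + L + c * d)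
  periodic-predMod {i} i<q c L with predMod-congruent i<q
  ... | t , 1+p≡i+tq = periodic-cong c (c * t * e) per (begin
    c * predMod q i + L + suc d * c     ≡⟨ regroup c (predMod q i) L d ⟩
    c * suc (predMod q i) + L + c * d   ≡⟨ cong (λ x → c * x + L + c * d) 1+p≡i+tq ⟩
    c * (i + t * q) + L + c * d         ≡⟨ expand c i t e d L ⟩
    c * i + L + c * d + suc d * (c * t * e) ∎)
    where
    open ≡-Reasoning
    regroup : ∀ c p L d → c * p + L + suc d * c ≡ c * suc p + L + c * d
    regroup = ℕ-Solver.solve-∀
    expand : ∀ c i t e d L → c * (i + t * (e * suc d)) + L + c * d ≡ c * i + L + c * d + suc d * (c * t * e)
    expand = ℕ-Solver.solve-∀

adjApply-linearForm : ∀ {d q m} {H : ℕ → ℤ} → 2 < q → suc d ∣ q → Periodic (suc d) H →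
  (cs : Vec ℕ m) (u : Vertex m q) → adjApply m q (H ∘ linearForm cs) u ≡ neighbourSum d cs H (linearForm cs u)
adjApply-linearForm {d} {q} 2<q (divides-refl e) = go
  where
  go : ∀ {m} {H : ℕ → ℤ} → Periodic (suc d) H → (cs : Vec ℕ m) (u : Vertex m q) →
       adjApply m q (H ∘ linearForm cs) u ≡ neighbourSum d cs H (linearForm cs u)
  go per []       []      = refl
  go {suc m} {H} per (c ∷ cs) (a ∷ u) = begin
    adjApply (suc m) q (H ∘ linearForm (c ∷ cs)) (a ∷ u)
      ≡⟨ adjApply-∷ (<-trans (ℕ.n<1+n 1) 2<q) (H ∘ linearForm (c ∷ cs)) a u ⟩
    ∑ (allFin q) (λ b → 𝟙 (cycleAdj a b) *ℤ H (c * toℕ b + L)) +ℤ adjApply m q (H′ ∘ linearForm cs) u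
      ≡⟨ cong₂ _+ℤ_ (∑-cycleAdj 2<q a (λ k → H (c * k + L))) (go per′ cs u) ⟩
    H (c * sucMod q (toℕ a) + L) +ℤ H (c * predMod q (toℕ a) + L) +ℤ neighbourSum d cs H′ L
      ≡⟨ cong₂ _+ℤ_ (cong₂ _+ℤ_ (periodic-sucMod {e = e} per c (toℕ a) L)
                                (periodic-predMod {e = e} per (toℕ<n a) c L))
                    (neighbourSum-shift d cs H (c * toℕ a) L) ⟩
    neighbourSum d (c ∷ cs) H (linearForm (c ∷ cs) (a ∷ u)) ∎
    where
    open ≡-Reasoning
    L = linearForm cs u
    H′ : ℕ → ℤ
    H′ s = H (c * toℕ a + s)
    per′ : Periodic (suc d) H′
    per′ s = trans (cong H (sym (ℕ.+-assoc (c * toℕ a) s (suc d)))) (per (c * toℕ a + s))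

linearForm-origin : ∀ {m q} (cs : Vec ℕ m) → linearForm {q = suc q} cs (replicate m Fin.zero) ≡ 0
linearForm-origin []       = refl
linearForm-origin (c ∷ cs) = cong₂ _+_ (ℕ.*-zeroʳ c) (linearForm-origin cs)

eigenvalue-linearForm : ∀ {d q m θ} {H : ℕ → ℤ} → 2 < q → suc d ∣ q → Periodic (suc d) H →
  (cs : Vec ℕ m) → (∀ s → neighbourSum d cs H s ≡ θ *ℤ H s) → H 0 ≢ 0ℤ → IsEigenvalue m q θ
eigenvalue-linearForm {H = H} 2<q@(s≤s _) d∣q per cs eig H0≢0 =
  eigenvector (H ∘ linearForm cs) (replicate _ Fin.zero , H0≢0 ∘ trans (cong H (sym (linearForm-origin cs))))
  λ u → trans (adjApply-linearForm 2<q d∣q per cs u) (eig (linearForm cs u))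

eigenvalue-constant : ∀ {q} → 2 < q → IsEigenvalue 1 q (+ 2)
eigenvalue-constant {q} 2<q =
  eigenvalue-linearForm {H = λ _ → 1ℤ} 2<q (1∣ q) (λ _ → refl) (0 ∷ []) (λ _ → refl) (λ ())

∑< : ℕ → (ℕ → ℤ) → ℤ
∑< zero    f = 0ℤ
∑< (suc n) f = f 0 +ℤ ∑< n (f ∘ suc)

∑<-cong : ∀ n {f g : ℕ → ℤ} → (∀ k → k < n → f k ≡ g k) → ∑< n f ≡ ∑< n g
∑<-cong zero    f≗g = refl
∑<-cong (suc n) f≗g = cong₂ _+ℤ_ (f≗g 0 (s≤s z≤n)) (∑<-cong n (λ k k<n → f≗g (suc k) (s≤s k<n)))

∑<-+ : ∀ n (f g : ℕ → ℤ) → ∑< n (λ k → f k +ℤ g k) ≡ ∑< n f +ℤ ∑< n g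
∑<-+ zero    f g = refl
∑<-+ (suc n) f g = trans (cong (f 0 +ℤ g 0 +ℤ_) (∑<-+ n (f ∘ suc) (g ∘ suc))) (swap (f 0) (g 0) _ _)
  where
  swap : ∀ a b c d → a +ℤ b +ℤ (c +ℤ d) ≡ a +ℤ c +ℤ (b +ℤ d)
  swap = ℤ-Solver.solve-∀

∑<-*ˡ : ∀ n (c : ℤ) (f : ℕ → ℤ) → ∑< n (λ k → c *ℤ f k) ≡ c *ℤ ∑< n f
∑<-*ˡ zero    c f = sym (ℤ.*-zeroʳ c)
∑<-*ˡ (suc n) c f = trans (cong (c *ℤ f 0 +ℤ_) (∑<-*ˡ n c (f ∘ suc))) (sym (ℤ.*-distribˡ-+ c (f 0) _))

∑<-const : ∀ n (c : ℤ) → ∑< n (λ _ → c) ≡ + n *ℤ c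
∑<-const zero    c = sym (ℤ.*-zeroˡ c)
∑<-const (suc n) c = trans (cong (c +ℤ_) (∑<-const n c)) (sym (ℤ.suc-* (+ n) c))

∑<-suc : ∀ n (f : ℕ → ℤ) → ∑< (suc n) f ≡ ∑< n f +ℤ f n
∑<-suc zero    f = ℤ.+-comm (f 0) 0ℤ
∑<-suc (suc n) f = trans (cong (f 0 +ℤ_) (∑<-suc n (f ∘ suc))) (sym (ℤ.+-assoc (f 0) _ _))

∑<-fold : ∀ m (g : ℕ → ℤ) → ∑< (m + m) g ≡ ∑< m (λ k → g k +ℤ g (m + m ∸ suc k))
∑<-fold zero    g = refl
∑<-fold (suc m) g rewrite ℕ.+-suc m m = begin
  g 0 +ℤ ∑< (suc (m + m)) (g ∘ suc)
    ≡⟨ cong (g 0 +ℤ_) (∑<-suc (m + m) (g ∘ suc)) ⟩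
  g 0 +ℤ (∑< (m + m) (g ∘ suc) +ℤ g (suc (m + m)))
    ≡⟨ cong (λ x → g 0 +ℤ (x +ℤ g (suc (m + m)))) (∑<-fold m (g ∘ suc)) ⟩
  g 0 +ℤ (∑< m (λ k → g (suc k) +ℤ g (suc (m + m ∸ suc k))) +ℤ g (suc (m + m)))
    ≡⟨ swap (g 0) _ (g (suc (m + m))) ⟩
  g 0 +ℤ g (suc (m + m)) +ℤ ∑< m (λ k → g (suc k) +ℤ g (suc (m + m ∸ suc k)))
    ≡⟨ cong (g 0 +ℤ g (suc (m + m)) +ℤ_) (∑<-cong m (λ k k<m → cong (λ i → g (suc k) +ℤ g i)
         (sym (ℕ.+-∸-assoc 1 (ℕ.≤-trans k<m (ℕ.m≤m+n m m)))))) ⟩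
  g 0 +ℤ g (suc (m + m)) +ℤ ∑< m (λ k → g (suc k) +ℤ g (m + m ∸ k)) ∎
  where
  open ≡-Reasoning
  swap : ∀ a b c → a +ℤ (b +ℤ c) ≡ a +ℤ c +ℤ b
  swap = ℤ-Solver.solve-∀

δ : ℕ → ℕ → ℤ
δ d s = 𝟙 (s % suc d ≡ᵇ 0)

δ-periodic : ∀ d → Periodic (suc d) (δ d)
δ-periodic d s = cong (λ r → 𝟙 (r ≡ᵇ 0)) ([m+n]%n≡m%n s (suc d))

δ-window : ∀ d s → ∑< (suc d) (λ j → δ d (s + j)) ≡ 1ℤ
δ-window d zero = cong (1ℤ +ℤ_) (begin
  ∑< d (λ k → δ d (suc k))
    ≡⟨ ∑<-cong d (λ k k<d → cong (λ r → 𝟙 (r ≡ᵇ 0)) (m<n⇒m%n≡m (s≤s k<d))) ⟩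
  ∑< d (λ _ → 0ℤ)
    ≡⟨ trans (∑<-const d 0ℤ) (ℤ.*-zeroʳ (+ d)) ⟩
  0ℤ ∎)
  where open ≡-Reasoning
δ-window d (suc s) = begin
  ∑< (suc d) (λ j → δ d (suc s + j))
    ≡⟨ ∑<-suc d (λ j → δ d (suc s + j)) ⟩
  ∑< d (λ j → δ d (suc s + j)) +ℤ δ d (suc s + d)
    ≡⟨ cong₂ _+ℤ_ (∑<-cong d (λ j _ → cong (δ d) (sym (ℕ.+-suc s j))))
                  (trans (cong (δ d) (sym (ℕ.+-suc s d))) (δ-periodic d s)) ⟩
  ∑< d (λ j → δ d (s + suc j)) +ℤ δ d s
    ≡⟨ ℤ.+-comm (∑< d (λ j → δ d (s + suc j))) (δ d s) ⟩
  δ d s +ℤ ∑< d (λ j → δ d (s + suc j))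
    ≡⟨ cong (λ x → δ d x +ℤ ∑< d (λ j → δ d (s + suc j))) (sym (ℕ.+-identityʳ s)) ⟩
  ∑< (suc d) (λ j → δ d (s + j))
    ≡⟨ δ-window d s ⟩
  1ℤ ∎
  where open ≡-Reasoning

complement : ∀ {x y} → x +ℤ y ≡ 1ℤ → y ≡ 1ℤ -ℤ x
complement {x} {y} x+y≡1 = trans (sym (cancel x y)) (cong (_-ℤ x) x+y≡1)
  where
  cancel : ∀ x y → x +ℤ y -ℤ x ≡ y
  cancel = ℤ-Solver.solve-∀

eigenvalue-alternating : ∀ {q} → 2 < q → 2 ∣ q → IsEigenvalue 1 q (- + 2)
eigenvalue-alternating 2<q 2∣q = eigenvalue-linearForm {H = H} 2<q 2∣q per (1 ∷ []) eig (λ ())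
  where
  H : ℕ → ℤ
  H s = + 2 *ℤ δ 1 s +ℤ -1ℤ
  per : Periodic 2 H
  per s = cong (λ x → + 2 *ℤ x +ℤ -1ℤ) (δ-periodic 1 s)
  eig : ∀ s → neighbourSum 1 (1 ∷ []) H s ≡ - + 2 *ℤ H s
  eig s = begin
    H (s + 1) +ℤ H (s + 1) +ℤ 0ℤ
      ≡⟨ cong (λ y → + 2 *ℤ y +ℤ -1ℤ +ℤ (+ 2 *ℤ y +ℤ -1ℤ) +ℤ 0ℤ) (complement {δ 1 s} window) ⟩
    + 2 *ℤ (1ℤ -ℤ δ 1 s) +ℤ -1ℤ +ℤ (+ 2 *ℤ (1ℤ -ℤ δ 1 s) +ℤ -1ℤ) +ℤ 0ℤ
      ≡⟨ simplify (δ 1 s) ⟩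
    - + 2 *ℤ H s ∎
    where
    open ≡-Reasoning
    window : δ 1 s +ℤ δ 1 (s + 1) ≡ 1ℤ
    window = trans (cong₂ _+ℤ_ (cong (δ 1) (sym (ℕ.+-identityʳ s))) (sym (ℤ.+-identityʳ _))) (δ-window 1 s)
    simplify : ∀ x → + 2 *ℤ (1ℤ -ℤ x) +ℤ -1ℤ +ℤ (+ 2 *ℤ (1ℤ -ℤ x) +ℤ -1ℤ) +ℤ 0ℤ
                     ≡ - + 2 *ℤ (+ 2 *ℤ x +ℤ -1ℤ)
    simplify = ℤ-Solver.solve-∀

neighbourSum-tabulate : ∀ d m (g : ℕ → ℕ) H s →
  neighbourSum d (Vec.tabulate {n = m} (g ∘ toℕ)) H s ≡ ∑< m (λ k → H (s + g k) +ℤ H (s + g k * d))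
neighbourSum-tabulate d zero    g H s = refl
neighbourSum-tabulate d (suc m) g H s =
  cong (H (s + g 0) +ℤ H (s + g 0 * d) +ℤ_) (neighbourSum-tabulate d m (g ∘ suc) H s)

δ-reflect : ∀ {d k} s → k < d → δ d (s + suc k * d) ≡ δ d (s + suc (d ∸ suc k))
δ-reflect {d} {k} s k<d =
  periodic-cong {H = δ d} {x = s + suc k * d} {y = s + suc (d ∸ suc k)} 0 k (δ-periodic d) (arith (ℕ.m∸n+n≡m k<d))
  where
  arith : ∀ {a} → a + suc k ≡ d → s + suc k * d + suc d * 0 ≡ s + suc a + suc d * k
  arith {a} refl = expand a k s
    where
    expand : ∀ a k s → s + suc k * (a + suc k) + suc (a + suc k) * 0 ≡ s + suc a + suc (a + suc k) * k
    expand = ℕ-Solver.solve-∀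

δ-symmetricWindow : ∀ m s →
  δ (m + m) s +ℤ ∑< m (λ k → δ (m + m) (s + suc k) +ℤ δ (m + m) (s + suc k * (m + m))) ≡ 1ℤ
δ-symmetricWindow m s = begin
  δ d s +ℤ ∑< m (λ k → g k +ℤ δ d (s + suc k * d))
    ≡⟨ cong (δ d s +ℤ_) (∑<-cong m (λ k k<m →
         cong (g k +ℤ_) (δ-reflect s (ℕ.≤-trans k<m (ℕ.m≤m+n m m))))) ⟩
  δ d s +ℤ ∑< m (λ k → g k +ℤ g (d ∸ suc k))
    ≡⟨ cong (δ d s +ℤ_) (sym (∑<-fold m g)) ⟩
  δ d s +ℤ ∑< d g
    ≡⟨ cong (λ x → δ d x +ℤ ∑< d g) (sym (ℕ.+-identityʳ s)) ⟩
  ∑< (suc d) (λ j → δ d (s + j))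
    ≡⟨ δ-window d s ⟩
  1ℤ ∎
  where
  open ≡-Reasoning
  d = m + m
  g : ℕ → ℤ
  g j = δ d (s + suc j)

-- With ω a primitive (2m+1)-th root of unity, (2m+1)[2m+1 ∣ x₁ + 2x₂ + ⋯ + m xₘ] - 1 is the sum of the
-- characters ω^(j(x₁ + 2x₂ + ⋯ + m xₘ)), j ≢ 0, each of eigenvalue Σₖ 2cos(2πjk/(2m+1)) = -1.
eigenvalue-minusOne : ∀ {q m} → 2 < q → suc (m + m) ∣ q → 0 < m → IsEigenvalue m q -1ℤ
eigenvalue-minusOne {q} {suc m′} 2<q p∣q _ =
  eigenvalue-linearForm {H = H} 2<q p∣q per cs eig H0≢0
  where
  m = suc m′
  d = m + m
  cs : Vec ℕ m
  cs = Vec.tabulate (suc ∘ toℕ)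
  P : ℤ
  P = + suc d
  H : ℕ → ℤ
  H s = P *ℤ δ d s +ℤ -1ℤ
  per : Periodic (suc d) H
  per s = cong (λ x → P *ℤ x +ℤ -1ℤ) (δ-periodic d s)
  H0≢0 : H 0 ≢ 0ℤ
  H0≢0 H0≡0 with trans (sym (cong (_+ℤ -1ℤ) (ℤ.*-identityʳ P))) H0≡0
  ... | ()
  P≡1+m+m : P ≡ 1ℤ +ℤ + m +ℤ + m
  P≡1+m+m = trans (ℤ.pos-+ 1 d) (trans (cong (1ℤ +ℤ_) (ℤ.pos-+ m m)) (sym (ℤ.+-assoc 1ℤ (+ m) (+ m))))
  eig : ∀ s → neighbourSum d cs H s ≡ -1ℤ *ℤ H s
  eig s = begin
    neighbourSum d cs H s
      ≡⟨ neighbourSum-tabulate d m suc H s ⟩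
    ∑< m (λ k → H (s + suc k) +ℤ H (s + suc k * d))
      ≡⟨ ∑<-cong m (λ k _ → regroup P (δ d (s + suc k)) (δ d (s + suc k * d))) ⟩
    ∑< m (λ k → P *ℤ D k +ℤ (-1ℤ +ℤ -1ℤ))
      ≡⟨ ∑<-+ m (λ k → P *ℤ D k) (λ _ → -1ℤ +ℤ -1ℤ) ⟩
    ∑< m (λ k → P *ℤ D k) +ℤ ∑< m (λ _ → -1ℤ +ℤ -1ℤ)
      ≡⟨ cong₂ _+ℤ_ (∑<-*ˡ m P D) (∑<-const m (-1ℤ +ℤ -1ℤ)) ⟩
    P *ℤ ∑< m D +ℤ + m *ℤ (-1ℤ +ℤ -1ℤ)
      ≡⟨ cong (λ x → P *ℤ x +ℤ + m *ℤ (-1ℤ +ℤ -1ℤ)) (complement {δ d s} (δ-symmetricWindow m s)) ⟩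
    P *ℤ (1ℤ -ℤ δ d s) +ℤ + m *ℤ (-1ℤ +ℤ -1ℤ)
      ≡⟨ cong (λ x → x *ℤ (1ℤ -ℤ δ d s) +ℤ + m *ℤ (-1ℤ +ℤ -1ℤ)) P≡1+m+m ⟩
    (1ℤ +ℤ + m +ℤ + m) *ℤ (1ℤ -ℤ δ d s) +ℤ + m *ℤ (-1ℤ +ℤ -1ℤ)
      ≡⟨ simplify (+ m) (δ d s) ⟩
    -1ℤ *ℤ ((1ℤ +ℤ + m +ℤ + m) *ℤ δ d s +ℤ -1ℤ)
      ≡⟨ cong (λ x → -1ℤ *ℤ (x *ℤ δ d s +ℤ -1ℤ)) (sym P≡1+m+m) ⟩
    -1ℤ *ℤ H s ∎
    where
    open ≡-Reasoning
    D : ℕ → ℤ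
    D k = δ d (s + suc k) +ℤ δ d (s + suc k * d)
    regroup : ∀ P x y → P *ℤ x +ℤ -1ℤ +ℤ (P *ℤ y +ℤ -1ℤ) ≡ P *ℤ (x +ℤ y) +ℤ (-1ℤ +ℤ -1ℤ)
    regroup = ℤ-Solver.solve-∀
    simplify : ∀ m x → (1ℤ +ℤ m +ℤ m) *ℤ (1ℤ -ℤ x) +ℤ m *ℤ (-1ℤ +ℤ -1ℤ)
                       ≡ -1ℤ *ℤ ((1ℤ +ℤ m +ℤ m) *ℤ x +ℤ -1ℤ)
    simplify = ℤ-Solver.solve-∀

modularInverse : ∀ {m} n → Coprime m (suc (suc n)) → ∃₂ λ x y → x * m ≡ 1 + y * suc (suc n)
modularInverse {m} n cop with coprime-Bézout cop
... | Bézout.+- x y 1+yA≡xm = x , y , sym 1+yA≡xm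
... | Bézout.-+ x zero    ()
... | Bézout.-+ x (suc y) 1+xm≡A+yA =
  x * suc n , n + suc n * y ,
  ℕ.+-cancelʳ-≡ (suc n) _ _ (trans (multiply n x m) (trans (cong (suc n *_) 1+xm≡A+yA) (sym (expand n y))))
  where
  multiply : ∀ n x m → x * suc n * m + suc n ≡ suc n * (1 + x * m)
  multiply = ℕ-Solver.solve-∀
  expand : ∀ n y → 1 + (n + suc n * y) * suc (suc n) + suc n ≡ suc n * (suc y * suc (suc n))
  expand = ℕ-Solver.solve-∀

frobenius-bound : ∀ {a b c N u v} → c ≤ a → a * b ≤ N → c * suc b + suc a * u ≡ N + suc a * v → v ≤ u
frobenius-bound {a} {b} {c} {N} {u} {v} c≤a ab≤N eq =
  ℕ.≤-pred (ℕ.*-cancelˡ-< (suc a) v (suc u) (ℕ.+-cancelˡ-< N (suc a * v) (suc a * suc u) chain))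
  where
  open ℕ.≤-Reasoning
  chain : N + suc a * v < N + suc a * suc u
  chain = begin-strict
    N + suc a * v          ≡⟨ sym eq ⟩
    c * suc b + suc a * u  ≤⟨ ℕ.+-monoˡ-≤ (suc a * u) (ℕ.*-monoˡ-≤ (suc b) c≤a) ⟩
    a * suc b + suc a * u  ≡⟨ split a b u ⟩
    a * b + a + suc a * u  <⟨ ℕ.+-monoˡ-< (suc a * u) (ℕ.+-mono-≤-< ab≤N (ℕ.n<1+n a)) ⟩
    N + suc a + suc a * u  ≡⟨ merge N a u ⟩
    N + suc a * suc u      ∎
    where
    split : ∀ a b u → a * suc b + suc a * u ≡ a * b + a + suc a * u
    split = ℕ-Solver.solve-∀
    merge : ∀ N a u → N + suc a + suc a * u ≡ N + suc a * suc u
    merge = ℕ-Solver.solve-∀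

frobenius : ∀ {a b} N → Coprime (suc a) (suc b) → a * b ≤ N → ∃₂ λ x y → N ≡ x * suc a + y * suc b
frobenius {zero} N _ _ = N , 0 , sym (trans (ℕ.+-identityʳ _) (ℕ.*-identityʳ N))
frobenius {suc a} {b} N cop ab≤N with modularInverse a (Coprime.sym cop)
... | X , Y , XB≡1+YA = Q * B ∸ N * Y , c , sym (ℕ.+-cancelʳ-≡ (A * (N * Y)) _ _ (begin
  (Q * B ∸ N * Y) * A + c * B + A * (N * Y) ≡⟨ regroup (Q * B ∸ N * Y) A c B (N * Y) ⟩
  c * B + A * (Q * B ∸ N * Y + N * Y)        ≡⟨ cong (λ x → c * B + A * x) (ℕ.m∸n+n≡m NY≤QB) ⟩
  c * B + A * (Q * B)                        ≡⟨ congruence ⟩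
  N + A * (N * Y)                            ∎))
  where
  open ≡-Reasoning
  A = suc (suc a)
  B = suc b
  c = (N * X) % A
  Q = (N * X) / A
  congruence : c * B + A * (Q * B) ≡ N + A * (N * Y)
  congruence = begin
    c * B + A * (Q * B) ≡⟨ factor c B A Q ⟩
    (c + Q * A) * B     ≡⟨ cong (_* B) (sym (m≡m%n+[m/n]*n (N * X) A)) ⟩
    N * X * B           ≡⟨ ℕ.*-assoc N X B ⟩
    N * (X * B)         ≡⟨ cong (N *_) XB≡1+YA ⟩
    N * (1 + Y * A)     ≡⟨ expand N Y A ⟩
    N + A * (N * Y)     ∎
    where
    factor : ∀ c B A Q → c * B + A * (Q * B) ≡ (c + Q * A) * B
    factor = ℕ-Solver.solve-∀
    expand : ∀ N Y A → N * (1 + Y * A) ≡ N + A * (N * Y)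
    expand = ℕ-Solver.solve-∀
  NY≤QB : N * Y ≤ Q * B
  NY≤QB = frobenius-bound (ℕ.≤-pred (m%n<n (N * X) A)) ab≤N congruence
  regroup : ∀ x A c B y → x * A + c * B + A * y ≡ c * B + A * (x + y)
  regroup = ℕ-Solver.solve-∀

double-suc : ∀ x c → 2 * suc x + c ≡ suc (suc (2 * x + c))
double-suc = ℕ-Solver.solve-∀

halveOdd : ∀ n X c → 2 * n + 1 ≡ 2 * X + c → ∃ λ z → c ≡ 2 * z + 1 × n ≡ X + z
halveOdd n       zero    c e = n , sym e , refl
halveOdd zero    (suc X) c e = ⊥-elim (ℕ.0≢1+n (ℕ.suc-injective (trans e (double-suc X c))))
halveOdd (suc n) (suc X) c e
  with halveOdd n X c (ℕ.suc-injective (ℕ.suc-injective (trans (sym (double-suc n 1)) (trans e (double-suc X c)))))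
... | z , c≡2z+1 , n≡X+z = z , c≡2z+1 , cong suc n≡X+z

odd-coprime-2 : ∀ m → Coprime (suc (m + m)) 2
odd-coprime-2 zero    = Coprime.1-coprimeTo 2
odd-coprime-2 (suc m) rewrite ℕ.+-suc m m = Coprime.coprime-+ (odd-coprime-2 m)

-- Frobenius writes 2n+1 = c₀p₀ + c₁p₁; then c₀ + c₁ = 2z+1 is odd and n = c₀m₀ + c₁m₁ + z,
-- so c₀ + c₁ blocks of eigenvalue -1 and z constant blocks of eigenvalue 2 fill the n coordinates.
eigenvalue-minusOne-odd : ∀ {q m₀ m₁ n} → 2 < q → suc (m₀ + m₀) ∣ q → suc (m₁ + m₁) ∣ q →
  0 < m₀ → 0 < m₁ → Coprime (suc (m₀ + m₀)) (suc (m₁ + m₁)) → (m₀ + m₀) * (m₁ + m₁) ≤ 2 * n + 1 →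
  IsEigenvalue n q -1ℤ
eigenvalue-minusOne-odd {q} {m₀} {m₁} {n} 2<q p₀∣q p₁∣q 0<m₀ 0<m₁ cop bound
  with frobenius (2 * n + 1) cop bound
... | c₀ , c₁ , 2n+1≡
  with halveOdd n (c₀ * m₀ + c₁ * m₁) (c₀ + c₁) (trans 2n+1≡ (regroup c₀ m₀ c₁ m₁))
  where
  regroup : ∀ c₀ m₀ c₁ m₁ →
            c₀ * suc (m₀ + m₀) + c₁ * suc (m₁ + m₁) ≡ 2 * (c₀ * m₀ + c₁ * m₁) + (c₀ + c₁)
  regroup = ℕ-Solver.solve-∀
... | z , c₀+c₁≡2z+1 , n≡ = subst₂ (λ n θ → IsEigenvalue n q θ) size value
  (eigenvalue-□ 1<q (eigenvalue-□-power 1<q (eigenvalue-minusOne 2<q p₀∣q 0<m₀) c₀)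
    (eigenvalue-□ 1<q (eigenvalue-□-power 1<q (eigenvalue-minusOne 2<q p₁∣q 0<m₁) c₁)
                      (eigenvalue-□-power 1<q (eigenvalue-constant 2<q) z)))
  where
  1<q : 1 < q
  1<q = <-trans (ℕ.n<1+n 1) 2<q
  size : c₀ * m₀ + (c₁ * m₁ + z * 1) ≡ n
  size = trans (regroup c₀ m₀ c₁ m₁ z) (sym n≡)
    where
    regroup : ∀ c₀ m₀ c₁ m₁ z → c₀ * m₀ + (c₁ * m₁ + z * 1) ≡ c₀ * m₀ + c₁ * m₁ + z
    regroup = ℕ-Solver.solve-∀
  value : + c₀ *ℤ -1ℤ +ℤ (+ c₁ *ℤ -1ℤ +ℤ + z *ℤ + 2) ≡ -1ℤ
  value = begin
    + c₀ *ℤ -1ℤ +ℤ (+ c₁ *ℤ -1ℤ +ℤ + z *ℤ + 2)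
      ≡⟨ regroup (+ c₀) (+ c₁) (+ z) ⟩
    + z *ℤ + 2 -ℤ (+ c₀ +ℤ + c₁)
      ≡⟨ cong (λ x → + z *ℤ + 2 -ℤ x) (trans (sym (ℤ.pos-+ c₀ c₁)) (cong +_ c₀+c₁≡2z+1)) ⟩
    + z *ℤ + 2 -ℤ + (2 * z + 1)
      ≡⟨ cong (λ x → + z *ℤ + 2 -ℤ x) (trans (ℤ.pos-+ (2 * z) 1) (cong (_+ℤ 1ℤ) (ℤ.pos-* 2 z))) ⟩
    + z *ℤ + 2 -ℤ (+ 2 *ℤ + z +ℤ 1ℤ)
      ≡⟨ cancel (+ z) ⟩
    -1ℤ ∎
    where
    open ≡-Reasoning
    regroup : ∀ c₀ c₁ z → c₀ *ℤ -1ℤ +ℤ (c₁ *ℤ -1ℤ +ℤ z *ℤ + 2) ≡ z *ℤ + 2 -ℤ (c₀ +ℤ c₁)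
    regroup = ℤ-Solver.solve-∀
    cancel : ∀ z → z *ℤ + 2 -ℤ (+ 2 *ℤ z +ℤ 1ℤ) ≡ -1ℤ
    cancel = ℤ-Solver.solve-∀

-- The eigenvalue 0 occurs in dimension 2 (constant □ alternating) and in dimension 2m+1
-- (constant □ two -1 blocks); Frobenius for 2 and 2m+1 reaches every dimension from 2m on.
eigenvalue-minusOne-even : ∀ {q m n} → 2 < q → 2 ∣ q → suc (m + m) ∣ q → 0 < m → 3 * m ≤ n →
                           IsEigenvalue n q -1ℤ
eigenvalue-minusOne-even {q} {m} {n} 2<q 2∣q p∣q 0<m 3m≤n =
  assemble (frobenius (n ∸ m) (Coprime.sym (odd-coprime-2 m)) (ℕ.m+n≤o⇒m≤o∸n (1 * (m + m)) 2m+m≤n))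
  where
  2m+m≤n : 1 * (m + m) + m ≤ n
  2m+m≤n = subst (_≤ n) (triple m) 3m≤n
    where
    triple : ∀ m → 3 * m ≡ 1 * (m + m) + m
    triple = ℕ-Solver.solve-∀
  1<q : 1 < q
  1<q = <-trans (ℕ.n<1+n 1) 2<q
  B : IsEigenvalue m q -1ℤ
  B = eigenvalue-minusOne 2<q p∣q 0<m
  Z₂ : IsEigenvalue 2 q 0ℤ
  Z₂ = eigenvalue-□ 1<q (eigenvalue-constant 2<q) (eigenvalue-alternating 2<q 2∣q)
  Zₚ : IsEigenvalue (suc (m + m)) q 0ℤ
  Zₚ = eigenvalue-□ 1<q (eigenvalue-constant 2<q) (eigenvalue-□ 1<q B B)
  assemble : (∃₂ λ x y → n ∸ m ≡ x * 2 + y * suc (m + m)) → IsEigenvalue n q -1ℤ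
  assemble (x , y , n∸m≡) = subst₂ (λ n θ → IsEigenvalue n q θ) size value
    (eigenvalue-□ 1<q B (eigenvalue-□ 1<q (eigenvalue-□-power 1<q Z₂ x) (eigenvalue-□-power 1<q Zₚ y)))
    where
    size : m + (x * 2 + y * suc (m + m)) ≡ n
    size = trans (cong (_+_ m) (sym n∸m≡)) (ℕ.m+[n∸m]≡n (ℕ.≤-trans (ℕ.m≤m+n m (2 * m)) 3m≤n))
    value : -1ℤ +ℤ (+ x *ℤ 0ℤ +ℤ + y *ℤ 0ℤ) ≡ -1ℤ
    value = cong₂ (λ a b → -1ℤ +ℤ (a +ℤ b)) (ℤ.*-zeroʳ (+ x)) (ℤ.*-zeroʳ (+ y))

∣-prodFin : ∀ r (g : Fin r → ℕ) i → g i ∣ prodFin r g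
∣-prodFin (suc r) g Fin.zero    = m∣m*n (prodFin r (g ∘ Fin.suc))
∣-prodFin (suc r) g (Fin.suc i) = ∣-trans (∣-prodFin r (g ∘ Fin.suc) i) (n∣m*n (g Fin.zero))

prodFin-nonZero : ∀ r (g : Fin r → ℕ) → (∀ i → NonZero (g i)) → NonZero (prodFin r g)
prodFin-nonZero zero    g nz = _
prodFin-nonZero (suc r) g nz =
  ℕ.m*n≢0 (g Fin.zero) _ {{nz Fin.zero}} {{prodFin-nonZero r (g ∘ Fin.suc) (nz ∘ Fin.suc)}}

m∣m^k : ∀ m k → 1 ≤ k → m ∣ m ^ k
m∣m^k m (suc k) _ = m∣m*n (m ^ k)

odd⇒suc[m+m] : ∀ {p} → ¬ 2 ∣ p → ∃ λ m → p ≡ suc (m + m)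
odd⇒suc[m+m] {p} 2∤p = byRemainder (p % 2) (m≡m%n+[m/n]*n p 2) (m%n<n p 2)
  where
  double : ∀ m → 1 + m * 2 ≡ suc (m + m)
  double = ℕ-Solver.solve-∀
  byRemainder : ∀ ρ → p ≡ ρ + p / 2 * 2 → ρ < 2 → ∃ λ m → p ≡ suc (m + m)
  byRemainder zero          p≡ _ = ⊥-elim (2∤p (divides (p / 2) p≡))
  byRemainder (suc zero)    p≡ _ = p / 2 , trans p≡ (double (p / 2))
  byRemainder (suc (suc ρ)) _ (s≤s (s≤s ()))

oddPrime : ∀ {p} → Prime p → 2 < p → ¬ 2 ∣ p
oddPrime p-prime 2<p 2∣p with prime⇒irreducible p-prime 2∣p
... | inj₁ ()
... | inj₂ 2≡p = ℕ.<-irrefl 2≡p 2<p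

suc[m+m]>1⇒m>0 : ∀ {m} → 1 < suc (m + m) → 0 < m
suc[m+m]>1⇒m>0 {zero}  (s≤s ())
suc[m+m]>1⇒m>0 {suc m} _ = s≤s z≤n

double<odd⇒≤ : ∀ {x n} → 2 * x < 2 * n + 1 → x ≤ n
double<odd⇒≤ {x} {n} 2x<2n+1 = ℕ.*-cancelˡ-≤ 2 (ℕ.≤-pred (subst (2 * x <_) (ℕ.+-comm (2 * n) 1) 2x<2n+1))

eigenvalue-minusOne-evenModulus : ∀ {q p₀ p₁ n} → 2 < q → 2 ∣ q → p₁ ∣ q → 1 < p₀ → 1 < p₁ →
  ¬ 2 ∣ p₁ → (2 * p₀ ∸ 1) * (p₁ ∸ 1) < 2 * n + 1 → IsEigenvalue n q -1ℤ
eigenvalue-minusOne-evenModulus {p₀ = p₀} {n = n} 2<q 2∣q p₁∣q 1<p₀ 1<p₁ 2∤p₁ bound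
  with odd⇒suc[m+m] 2∤p₁
... | m , refl =
  eigenvalue-minusOne-even {m = m} 2<q 2∣q p₁∣q (suc[m+m]>1⇒m>0 1<p₁) (double<odd⇒≤ (begin-strict
  2 * (3 * m)              ≡⟨ reorder m ⟩
  3 * (m + m)              ≤⟨ ℕ.*-monoˡ-≤ (m + m) (ℕ.∸-monoˡ-≤ 1 (ℕ.*-monoʳ-≤ 2 1<p₀)) ⟩
  (2 * p₀ ∸ 1) * (m + m)   <⟨ bound ⟩
  2 * n + 1                ∎))
  where
  open ℕ.≤-Reasoning
  reorder : ∀ m → 2 * (3 * m) ≡ 3 * (m + m)
  reorder = ℕ-Solver.solve-∀

eigenvalue-minusOne-oddModulus : ∀ {q p₀ p₁ n} → 2 < q → p₀ ∣ q → p₁ ∣ q → 1 < p₀ → 1 < p₁ →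
  ¬ 2 ∣ p₀ → ¬ 2 ∣ p₁ → Coprime p₀ p₁ → (p₀ ∸ 1) * (p₁ ∸ 1) < 2 * n + 1 →
  IsEigenvalue n q -1ℤ
eigenvalue-minusOne-oddModulus 2<q p₀∣q p₁∣q 1<p₀ 1<p₁ 2∤p₀ 2∤p₁ cop bound
  with odd⇒suc[m+m] 2∤p₀ | odd⇒suc[m+m] 2∤p₁
... | m₀ , refl | m₁ , refl = eigenvalue-minusOne-odd {m₀ = m₀} {m₁} 2<q p₀∣q p₁∣q
  (suc[m+m]>1⇒m>0 1<p₀) (suc[m+m]>1⇒m>0 1<p₁) cop (ℕ.<⇒≤ bound)

corollary4p13 : (q r : ℕ) (r>1 : 1 < r) (p a : Fin r → ℕ)
    → (∀ i → Prime (p i))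
    → (∀ i j → i <ᶠ j → p i < p j)
    → (∀ i → 1 ≤ a i)
    → q ≡ prodFin r (λ i → p i ^ a i)
    → (n : ℕ)
    → (2 ∣ q → (2 * p (fromℕ< (<-trans (s≤s z≤n) r>1)) ∸ 1) * (p (fromℕ< r>1) ∸ 1) < 2 * n + 1)
    → (¬ (2 ∣ q) → (p (fromℕ< (<-trans (s≤s z≤n) r>1)) ∸ 1) * (p (fromℕ< r>1) ∸ 1) < 2 * n + 1)
    → Σ (Vertex n q → ℤ) λ v
        → (∃ λ x → v x ≢ 0ℤ) × (∀ x → adjApply n q v x ≡ -1ℤ *ℤ v x)
corollary4p13 q r r>1 p a prime increasing a≥1 q≡ n evenBound oddBound = vector , nonzero , equation
  where
  i₀ i₁ : Fin r
  i₀ = fromℕ< (<-trans (s≤s z≤n) r>1)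
  i₁ = fromℕ< r>1
  p₀<p₁ : p i₀ < p i₁
  p₀<p₁ = increasing i₀ i₁ (subst₂ _<_ (sym (toℕ-fromℕ< _)) (sym (toℕ-fromℕ< r>1)) (s≤s z≤n))
  1<p : ∀ i → 1 < p i
  1<p i = nonTrivial⇒n>1 (p i) {{prime⇒nonTrivial (prime i)}}
  p∣q : ∀ i → p i ∣ q
  p∣q i = subst (p i ∣_) (sym q≡) (∣-trans (m∣m^k (p i) (a i) (a≥1 i)) (∣-prodFin r (λ j → p j ^ a j) i))
  instance
    q≢0 : NonZero q
    q≢0 = subst NonZero (sym q≡) (prodFin-nonZero r _ (λ i → ℕ.m^n≢0 (p i) (a i) {{prime⇒nonZero (prime i)}}))
  2<p₁ : 2 < p i₁
  2<p₁ = ℕ.≤-<-trans (1<p i₀) p₀<p₁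
  2<q : 2 < q
  2<q = ℕ.<-≤-trans 2<p₁ (∣⇒≤ (p∣q i₁))
  eigen : IsEigenvalue n q -1ℤ
  eigen with 2 ∣? q
  ... | yes 2∣q = eigenvalue-minusOne-evenModulus 2<q 2∣q (p∣q i₁) (1<p i₀) (1<p i₁)
                    (oddPrime (prime i₁) 2<p₁) (evenBound 2∣q)
  ... | no 2∤q = eigenvalue-minusOne-oddModulus 2<q (p∣q i₀) (p∣q i₁) (1<p i₀) (1<p i₁)
                   (2∤q ∘ flip ∣-trans (p∣q i₀)) (2∤q ∘ flip ∣-trans (p∣q i₁))
                   (Coprime.sym (prime⇒coprime (prime i₁) {{prime⇒nonZero (prime i₀)}} p₀<p₁)) (oddBound 2∤q)
  open IsEigenvalue eigen
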